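{- For all $n\ge 10$, $\beta_n\ge\alpha_n$ and $\delta_n\ge\gamma_n$, where the sequences are as defined in the context.
   Context: For a positive integer $a$ with decimal expansion $a=\sum_{i=0}^{k} c_i 10^i$, $c_i\in\{0,\dots,9\}$, $c_k\neq 0$, and an integer $b\ge 10$, let $a\_b:=\sum_{i=0}^{k} c_i b^i$ (the decimal digit string of $a$ interpreted in base $b$); this is again a positive integer. Define for $n\ge 10$: $\alpha_{10}=10$ and $\alpha_n = 10\_(11\_(12\_(\cdots\_((n-1)\_n)\cdots)))$ for $n\ge 11$; $\beta_{10}=10$ and $\beta_n = ((\cdots((10\_11)\_12)\cdots)\_(n-1))\_n$ for $n\ge 11$; $\gamma_{10}=10$ and $\gamma_n = n\_((n-1)\_(\cdots\_(12\_(11\_10))\cdots))$ for $n\ge 11$; $\delta_{10}=10$ and $\delta_n = ((\cdots((n\_(n-1))\_(n-2))\cdots)\_11)\_10$ for $n\ge 11$. -}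

module Defs where

open import Data.Nat using (ℕ; zero; suc; _+_; _*_; _∸_)
open import Data.List using (List; foldl)
open import Data.Digit using (toNatDigits)

decimalDigits : ℕ → List ℕ
decimalDigits a = toNatDigits 10 a

-- a _ b : the decimal digit string of a read in base b (Horner evaluation)
_⟪_⟫ : ℕ → ℕ → ℕ
a ⟪ b ⟫ = foldl (λ acc d → acc * b + d) 0 (decimalDigits a)

-- α_n = 10_(11_(...((n-1)_n)...)), right-nested.
-- αFrom m n = m_((m+1)_(..._n)) for m ≤ n, with αFrom n n = n.
-- Defined via k = number of remaining steps: αAux m k = m_((m+1)_(..._(m+k)))
αAux : ℕ → ℕ → ℕ
αAux m zero = m
αAux m (suc k) = m ⟪ αAux (suc m) k ⟫

α : ℕ → ℕ
α n = αAux 10 (n ∸ 10)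

-- β_n = ((10_11)_12 ..._(n-1))_n, left-nested.
-- βAux k = β_{10+k}
βAux : ℕ → ℕ
βAux zero = 10
βAux (suc k) = βAux k ⟪ 10 + suc k ⟫

β : ℕ → ℕ
β n = βAux (n ∸ 10)

-- γ_n = n_((n-1)_(..._(11_10))), right-nested; γAux k = γ_{10+k}
γAux : ℕ → ℕ
γAux zero = 10
γAux (suc k) = (10 + suc k) ⟪ γAux k ⟫

γ : ℕ → ℕ
γ n = γAux (n ∸ 10)

-- δ_n = ((n_(n-1))_(n-2) ..._11)_10, left-nested.
-- δAux x m : apply (_ ⟪ m ⟫), then (_ ⟪ m-1 ⟫), ..., down to (_ ⟪ 10 ⟫),
-- where m = 10 + j.
δAux : ℕ → ℕ → ℕ
δAux x zero = x ⟪ 10 ⟫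
δAux x (suc j) = δAux (x ⟪ 10 + suc j ⟫) j

δ : ℕ → ℕ
δ n with n ∸ 10
... | zero = 10
... | suc k = δAux (10 + suc k) k

-- Write H x = x ⟪ d ⟫ for a base d ≥ 10. A decimal carry trades 10·10ⁱ for
-- 10ⁱ⁺¹; read in base d it trades 10·dⁱ for dⁱ⁺¹ ≥ 10·dⁱ. Hence H is
-- superadditive and supermultiplicative, and r ≤ H r on digits. Applied to
-- a ⟪ c ⟫ = Σ aᵢ cⁱ this gives the rebracketing inequality
-- a ⟪ c ⟪ d ⟫ ⟫ ≤ a ⟪ c ⟫ ⟪ d ⟫. Pushing it through a right-nested tower,
-- one base at a time, turns α into β and γ into δ.
module Submission where

open import Defs
open import Data.Nat
open import Data.Nat.Properties
open import Data.Nat.DivMod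
open import Data.Nat.Divisibility using (n∣m*n)
open import Data.Nat.Induction using (<-rec; <-wellFounded-fast)
open import Induction.WellFounded using (Acc; acc)
open import Data.Nat.Tactic.RingSolver using (solve-∀)
open import Data.List using (List; []; _∷_; [_]; _++_; foldl)
open import Data.List.Properties using (++-assoc; foldl-++)
open import Data.Digit using (toNatDigits)
open import Data.Bool using (true; false)
open import Data.Product using (_×_; _,_)
open import Relation.Nullary using (yes; no)
open import Relation.Binary.PropositionalEquality
  using (_≡_; refl; sym; trans; cong; cong₂; subst; module ≡-Reasoning)

-- toNatDigits runs an accumulator loop local to its definition, which
-- cannot be named here. The metavariable digitLoop k is solved by unification
-- with that loop (k is the argument of the outer call) in the last clause of
-- toNatDigits-∷ʳ, whose generalised with-arguments make the equation a pattern.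
private
  DigitLoop : Set
  DigitLoop = ∀ {m} → Acc _<_ m → List ℕ → List ℕ

  1+k/10<1+k : ∀ k → suc k / 10 < suc k
  1+k/10<1+k k = m/n<m (suc k) 10 sz<ss

  /10-acc : ∀ {k} → Acc _<_ (suc k) → Acc _<_ (suc k / 10)
  /10-acc {k} (acc rs) = rs (1+k/10<1+k k)

  mutual
    digitLoop : ℕ → DigitLoop
    digitLoop k = _

    toNatDigits-∷ʳ : ∀ k → (0 <ᵇ suc k / 10) ≡ true →
      toNatDigits 10 (suc k) ≡ toNatDigits 10 (suc k / 10) ++ [ suc k % 10 ]
    toNatDigits-∷ʳ k _ with 0 <ᵇ suc k / 10
    ... | true with suc k / 10 | /10-acc (<-wellFounded-fast (suc k)) | [ suc k % 10 ]
    ...   | _ | a | xs = digitLoop-toNatDigits k a xs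

    digitLoop-irrelevant : ∀ k k′ {m} (a a′ : Acc _<_ m) xs → digitLoop k a xs ≡ digitLoop k′ a′ xs
    digitLoop-irrelevant k k′ {zero}  _        _         _  = refl
    digitLoop-irrelevant k k′ {suc m} (acc rs) (acc rs′) xs with 0 <ᵇ suc m / 10
    ... | false = refl
    ... | true  = digitLoop-irrelevant k k′ (rs (1+k/10<1+k m)) (rs′ (1+k/10<1+k m)) _

    digitLoop-++ : ∀ k {m} (a : Acc _<_ m) xs → digitLoop k a xs ≡ digitLoop k a [] ++ xs
    digitLoop-++ k {zero}  _        _  = refl
    digitLoop-++ k {suc m} (acc rs) xs with 0 <ᵇ suc m / 10
    ... | false = refl
    ... | true  = begin
      digitLoop k (rs q<m) (suc m % 10 ∷ xs)           ≡⟨ digitLoop-++ k (rs q<m) _ ⟩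
      digitLoop k (rs q<m) [] ++ suc m % 10 ∷ xs        ≡⟨ sym (++-assoc (digitLoop k (rs q<m) []) _ xs) ⟩
      (digitLoop k (rs q<m) [] ++ [ suc m % 10 ]) ++ xs ≡⟨ cong (_++ xs) (sym (digitLoop-++ k (rs q<m) _)) ⟩
      digitLoop k (rs q<m) [ suc m % 10 ] ++ xs         ∎
      where
      open ≡-Reasoning
      q<m : suc m / 10 < suc m
      q<m = 1+k/10<1+k m

    toNatDigits-digitLoop : ∀ m (a : Acc _<_ m) → toNatDigits 10 m ≡ digitLoop 0 a []
    toNatDigits-digitLoop zero    _ = refl
    toNatDigits-digitLoop (suc k) a = digitLoop-irrelevant k 0 (<-wellFounded-fast (suc k)) a []

    digitLoop-toNatDigits : ∀ k {m} (a : Acc _<_ m) xs → digitLoop k a xs ≡ toNatDigits 10 m ++ xs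
    digitLoop-toNatDigits k {m} a xs = begin
      digitLoop k a xs         ≡⟨ digitLoop-++ k a xs ⟩
      digitLoop k a [] ++ xs   ≡⟨ cong (_++ xs) (digitLoop-irrelevant k 0 a a []) ⟩
      digitLoop 0 a [] ++ xs   ≡⟨ cong (_++ xs) (sym (toNatDigits-digitLoop m a)) ⟩
      toNatDigits 10 m ++ xs   ∎
      where open ≡-Reasoning

toNatDigits-digit : ∀ k → (0 <ᵇ suc k / 10) ≡ false → toNatDigits 10 (suc k) ≡ [ suc k % 10 ]
toNatDigits-digit k _ with 0 <ᵇ suc k / 10
... | false = refl

⟪⟫-div-mod : ∀ b x → x ⟪ b ⟫ ≡ (x / 10) ⟪ b ⟫ * b + x % 10
⟪⟫-div-mod b zero    = refl
⟪⟫-div-mod b (suc k) = by-leading-digits (0 <ᵇ suc k / 10) refl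
  where
  open ≡-Reasoning
  step : ℕ → ℕ → ℕ
  step n digit = n * b + digit

  quotient≡0 : ∀ q → (0 <ᵇ q) ≡ false → q ≡ 0
  quotient≡0 zero    _  = refl
  quotient≡0 (suc _) ()

  by-leading-digits : ∀ c → (0 <ᵇ suc k / 10) ≡ c → suc k ⟪ b ⟫ ≡ (suc k / 10) ⟪ b ⟫ * b + suc k % 10
  by-leading-digits false q≯0 = begin
    foldl step 0 (toNatDigits 10 (suc k)) ≡⟨ cong (foldl step 0) (toNatDigits-digit k q≯0) ⟩
    suc k % 10                            ≡⟨ cong (λ q → q ⟪ b ⟫ * b + suc k % 10) (sym (quotient≡0 (suc k / 10) q≯0)) ⟩
    (suc k / 10) ⟪ b ⟫ * b + suc k % 10   ∎
  by-leading-digits true q>0 = begin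
    foldl step 0 (toNatDigits 10 (suc k))                        ≡⟨ cong (foldl step 0) (toNatDigits-∷ʳ k q>0) ⟩
    foldl step 0 (toNatDigits 10 (suc k / 10) ++ [ suc k % 10 ]) ≡⟨ foldl-++ step 0 (toNatDigits 10 (suc k / 10)) _ ⟩
    (suc k / 10) ⟪ b ⟫ * b + suc k % 10                          ∎

⟪⟫-horner : ∀ b q {r} → r < 10 → (r + q * 10) ⟪ b ⟫ ≡ q ⟪ b ⟫ * b + r
⟪⟫-horner b q {r} r<10 = begin
  (r + q * 10) ⟪ b ⟫                                        ≡⟨ ⟪⟫-div-mod b (r + q * 10) ⟩
  ((r + q * 10) / 10) ⟪ b ⟫ * b + (r + q * 10) % 10         ≡⟨ cong₂ (λ q′ r′ → q′ ⟪ b ⟫ * b + r′) quotient remainder ⟩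
  q ⟪ b ⟫ * b + r                                          ∎
  where
  open ≡-Reasoning
  remainder : (r + q * 10) % 10 ≡ r
  remainder = trans ([m+kn]%n≡m%n r q 10) (m<n⇒m%n≡m r<10)
  quotient : (r + q * 10) / 10 ≡ q
  quotient = trans (+-distrib-/-∣ʳ r (n∣m*n q)) (cong₂ _+_ (m<n⇒m/n≡0 r<10) (m*n/n≡m q 10))

⟪⟫-*10 : ∀ b q → (q * 10) ⟪ b ⟫ ≡ q ⟪ b ⟫ * b
⟪⟫-*10 b q = trans (⟪⟫-horner b q {0} z<s) (+-identityʳ _)

decimal-cases : (P : ℕ → Set) → (∀ q r → r < 10 → P (r + q * 10)) → ∀ x → P x
decimal-cases P step x = subst P (sym (m≡m%n+[m/n]*n x 10)) (step (x / 10) (x % 10) (m%n<n x 10))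

decimal-induction : (P : ℕ → Set) → P 0 → (∀ q r → r < 10 → P q → P (r + q * 10)) → ∀ x → P x
decimal-induction P base step = <-rec P go
  where
  go : ∀ x → (∀ {y} → y < x → P y) → P x
  go zero    _  = base
  go (suc k) ih = subst P (sym (m≡m%n+[m/n]*n (suc k) 10))
                        (step (suc k / 10) (suc k % 10) (m%n<n (suc k) 10) (ih (1+k/10<1+k k)))

module _ {d} (10≤d : 10 ≤ d) where
  open ≤-Reasoning

  m≤m⟪d⟫ : ∀ m → m ≤ m ⟪ d ⟫
  m≤m⟪d⟫ = decimal-induction (λ m → m ≤ m ⟪ d ⟫) z≤n λ q r r<10 q≤ → begin
    r + q * 10          ≤⟨ +-monoʳ-≤ r (*-mono-≤ q≤ 10≤d) ⟩
    r + q ⟪ d ⟫ * d     ≡⟨ +-comm r _ ⟩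
    q ⟪ d ⟫ * d + r     ≡⟨ ⟪⟫-horner d q r<10 ⟨
    (r + q * 10) ⟪ d ⟫  ∎

  -- For s ≥ 10 the carry turns 10 into d, and the second hypothesis
  -- absorbs it into the higher digits m.
  ⟪⟫-carry : ∀ {a} m s → a ≤ m ⟪ d ⟫ → suc (m ⟪ d ⟫) ≤ suc m ⟪ d ⟫ → s < 20 →
             a * d + s ≤ (s + m * 10) ⟪ d ⟫
  ⟪⟫-carry {a} m s a≤ _ _ with s <? 10
  ... | yes s<10 = begin
    a * d + s           ≤⟨ +-monoˡ-≤ s (*-monoˡ-≤ d a≤) ⟩
    m ⟪ d ⟫ * d + s     ≡⟨ ⟪⟫-horner d m s<10 ⟨
    (s + m * 10) ⟪ d ⟫  ∎
  ⟪⟫-carry {a} m s a≤ 1+m≤ s<20 | no s≮10 with m≤n⇒∃[o]m+o≡n (≮⇒≥ s≮10)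
  ... | e , refl = begin
    a * d + (10 + e)          ≡⟨ shuffle (a * d) e ⟩
    10 + (a * d + e)          ≤⟨ +-monoˡ-≤ (a * d + e) 10≤d ⟩
    d + (a * d + e)           ≡⟨ +-assoc d (a * d) e ⟨
    suc a * d + e             ≤⟨ +-monoˡ-≤ e (*-monoˡ-≤ d (≤-trans (s≤s a≤) 1+m≤)) ⟩
    suc m ⟪ d ⟫ * d + e       ≡⟨ ⟪⟫-horner d (suc m) (+-cancelˡ-< 10 e 10 s<20) ⟨
    (e + suc m * 10) ⟪ d ⟫    ≡⟨ cong _⟪ d ⟫ (shuffle e (m * 10)) ⟩
    (10 + e + m * 10) ⟪ d ⟫   ∎
    where
    shuffle : ∀ x y → x + (10 + y) ≡ 10 + (x + y)
    shuffle = solve-∀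

  1+m⟪d⟫≤[1+m]⟪d⟫ : ∀ m → suc (m ⟪ d ⟫) ≤ suc m ⟪ d ⟫
  1+m⟪d⟫≤[1+m]⟪d⟫ = decimal-induction (λ m → suc (m ⟪ d ⟫) ≤ suc m ⟪ d ⟫) (s≤s z≤n) λ q r r<10 ih → begin
    suc ((r + q * 10) ⟪ d ⟫)   ≡⟨ cong suc (⟪⟫-horner d q r<10) ⟩
    suc (q ⟪ d ⟫ * d + r)      ≡⟨ +-suc _ r ⟨
    q ⟪ d ⟫ * d + suc r        ≤⟨ ⟪⟫-carry q (suc r) ≤-refl ih (s≤s (≤-trans r<10 (m≤m+n 10 9))) ⟩
    (suc r + q * 10) ⟪ d ⟫     ∎

  ⟪⟫-superadditive : ∀ x y → x ⟪ d ⟫ + y ⟪ d ⟫ ≤ (x + y) ⟪ d ⟫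
  ⟪⟫-superadditive = decimal-induction (λ x → ∀ y → x ⟪ d ⟫ + y ⟪ d ⟫ ≤ (x + y) ⟪ d ⟫) (λ _ → ≤-refl)
    λ q r r<10 ih → decimal-cases (λ y → (r + q * 10) ⟪ d ⟫ + y ⟪ d ⟫ ≤ (r + q * 10 + y) ⟪ d ⟫)
    λ q′ r′ r′<10 → begin
      (r + q * 10) ⟪ d ⟫ + (r′ + q′ * 10) ⟪ d ⟫    ≡⟨ cong₂ _+_ (⟪⟫-horner d q r<10) (⟪⟫-horner d q′ r′<10) ⟩
      (q ⟪ d ⟫ * d + r) + (q′ ⟪ d ⟫ * d + r′)      ≡⟨ collect (q ⟪ d ⟫) (q′ ⟪ d ⟫) r r′ d ⟩
      (q ⟪ d ⟫ + q′ ⟪ d ⟫) * d + (r + r′)          ≤⟨ ⟪⟫-carry (q + q′) (r + r′) (ih q′) (1+m⟪d⟫≤[1+m]⟪d⟫ (q + q′)) (+-mono-< r<10 r′<10) ⟩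
      ((r + r′) + (q + q′) * 10) ⟪ d ⟫             ≡⟨ cong _⟪ d ⟫ (interleave r r′ q q′) ⟩
      (r + q * 10 + (r′ + q′ * 10)) ⟪ d ⟫          ∎
    where
    collect : ∀ a a′ r r′ b → (a * b + r) + (a′ * b + r′) ≡ (a + a′) * b + (r + r′)
    collect = solve-∀
    interleave : ∀ r r′ q q′ → (r + r′) + (q + q′) * 10 ≡ r + q * 10 + (r′ + q′ * 10)
    interleave = solve-∀

  k*m⟪d⟫≤[k*m]⟪d⟫ : ∀ k m → k * m ⟪ d ⟫ ≤ (k * m) ⟪ d ⟫
  k*m⟪d⟫≤[k*m]⟪d⟫ zero    m = z≤n
  k*m⟪d⟫≤[k*m]⟪d⟫ (suc k) m = ≤-trans (+-monoʳ-≤ (m ⟪ d ⟫) (k*m⟪d⟫≤[k*m]⟪d⟫ k m)) (⟪⟫-superadditive m (k * m))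

  ⟪⟫-supermultiplicative : ∀ x y → x ⟪ d ⟫ * y ⟪ d ⟫ ≤ (x * y) ⟪ d ⟫
  ⟪⟫-supermultiplicative = decimal-induction (λ x → ∀ y → x ⟪ d ⟫ * y ⟪ d ⟫ ≤ (x * y) ⟪ d ⟫) (λ _ → z≤n)
    λ q r r<10 ih y → begin
      (r + q * 10) ⟪ d ⟫ * y ⟪ d ⟫           ≡⟨ cong (_* y ⟪ d ⟫) (⟪⟫-horner d q r<10) ⟩
      (q ⟪ d ⟫ * d + r) * y ⟪ d ⟫            ≡⟨ distribute (q ⟪ d ⟫) r (y ⟪ d ⟫) d ⟩
      r * y ⟪ d ⟫ + q ⟪ d ⟫ * y ⟪ d ⟫ * d    ≤⟨ +-monoʳ-≤ (r * y ⟪ d ⟫) (*-monoˡ-≤ d (ih y)) ⟩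
      r * y ⟪ d ⟫ + (q * y) ⟪ d ⟫ * d        ≡⟨ cong (r * y ⟪ d ⟫ +_) (⟪⟫-*10 d (q * y)) ⟨
      r * y ⟪ d ⟫ + (q * y * 10) ⟪ d ⟫       ≤⟨ +-monoˡ-≤ _ (k*m⟪d⟫≤[k*m]⟪d⟫ r y) ⟩
      (r * y) ⟪ d ⟫ + (q * y * 10) ⟪ d ⟫     ≤⟨ ⟪⟫-superadditive (r * y) (q * y * 10) ⟩
      (r * y + q * y * 10) ⟪ d ⟫             ≡⟨ cong _⟪ d ⟫ (factor r y q) ⟩
      ((r + q * 10) * y) ⟪ d ⟫               ∎
    where
    distribute : ∀ a r c b → (a * b + r) * c ≡ r * c + a * c * b
    distribute = solve-∀
    factor : ∀ r y q → r * y + q * y * 10 ≡ (r + q * 10) * y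
    factor = solve-∀

  a⟪c⟪d⟫⟫≤a⟪c⟫⟪d⟫ : ∀ a c → a ⟪ c ⟪ d ⟫ ⟫ ≤ (a ⟪ c ⟫) ⟪ d ⟫
  a⟪c⟪d⟫⟫≤a⟪c⟫⟪d⟫ a c = decimal-induction (λ a → a ⟪ c ⟪ d ⟫ ⟫ ≤ (a ⟪ c ⟫) ⟪ d ⟫) z≤n
    (λ q r r<10 ih → begin
      (r + q * 10) ⟪ c ⟪ d ⟫ ⟫              ≡⟨ ⟪⟫-horner (c ⟪ d ⟫) q r<10 ⟩
      q ⟪ c ⟪ d ⟫ ⟫ * c ⟪ d ⟫ + r           ≤⟨ +-monoˡ-≤ r (*-monoˡ-≤ (c ⟪ d ⟫) ih) ⟩
      (q ⟪ c ⟫) ⟪ d ⟫ * c ⟪ d ⟫ + r         ≤⟨ +-mono-≤ (⟪⟫-supermultiplicative (q ⟪ c ⟫) c) (m≤m⟪d⟫ r) ⟩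
      (q ⟪ c ⟫ * c) ⟪ d ⟫ + r ⟪ d ⟫         ≤⟨ ⟪⟫-superadditive (q ⟪ c ⟫ * c) r ⟩
      (q ⟪ c ⟫ * c + r) ⟪ d ⟫               ≡⟨ cong _⟪ d ⟫ (⟪⟫-horner c q r<10) ⟨
      ((r + q * 10) ⟪ c ⟫) ⟪ d ⟫            ∎) a

leftNest : ℕ → ℕ → ℕ → ℕ
leftNest x m zero    = x ⟪ m ⟫
leftNest x m (suc k) = leftNest (x ⟪ m ⟫) (suc m) k

10≤αAux : ∀ {m} k → 10 ≤ m → 10 ≤ αAux m k
10≤αAux zero    10≤m = 10≤m
10≤αAux {m} (suc k) 10≤m = ≤-trans 10≤m (m≤m⟪d⟫ (10≤αAux k (m≤n⇒m≤1+n 10≤m)) m)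

⟪αAux⟫≤leftNest : ∀ x {m} k → 10 ≤ m → x ⟪ αAux m k ⟫ ≤ leftNest x m k
⟪αAux⟫≤leftNest x zero    _    = ≤-refl
⟪αAux⟫≤leftNest x {m} (suc k) 10≤m =
  ≤-trans (a⟪c⟪d⟫⟫≤a⟪c⟫⟪d⟫ (10≤αAux k 10≤1+m) x m) (⟪αAux⟫≤leftNest (x ⟪ m ⟫) k 10≤1+m)
  where
  10≤1+m : 10 ≤ suc m
  10≤1+m = m≤n⇒m≤1+n 10≤m

leftNest-βAux : ∀ j k → leftNest (βAux j) (11 + j) k ≡ βAux (suc k + j)
leftNest-βAux j zero    = refl
leftNest-βAux j (suc k) = trans (leftNest-βAux (suc j) k) (cong βAux (cong suc (+-suc k j)))

α≤β : ∀ k → αAux 10 k ≤ βAux k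
α≤β zero    = ≤-refl
α≤β (suc k) = begin
  10 ⟪ αAux 11 k ⟫        ≤⟨ ⟪αAux⟫≤leftNest 10 k (n≤1+n 10) ⟩
  leftNest (βAux 0) 11 k  ≡⟨ leftNest-βAux 0 k ⟩
  βAux (suc k + 0)        ≡⟨ cong βAux (+-identityʳ (suc k)) ⟩
  βAux (suc k)            ∎
  where open ≤-Reasoning

10≤γAux : ∀ j → 10 ≤ γAux j
10≤γAux zero    = ≤-refl
10≤γAux (suc j) = ≤-trans (m≤m+n 10 (suc j)) (m≤m⟪d⟫ (10≤γAux j) (11 + j))

⟪γAux⟫≤δAux : ∀ x j → x ⟪ γAux j ⟫ ≤ δAux x j
⟪γAux⟫≤δAux x zero    = ≤-refl
⟪γAux⟫≤δAux x (suc j) =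
  ≤-trans (a⟪c⟪d⟫⟫≤a⟪c⟫⟪d⟫ (10≤γAux j) x (11 + j)) (⟪γAux⟫≤δAux (x ⟪ 11 + j ⟫) j)

theorem2 : (n : ℕ) → n ≥ 10 → (β n ≥ α n) × (δ n ≥ γ n)
theorem2 n _ with n ∸ 10
... | zero  = ≤-refl , ≤-refl
... | suc k = α≤β (suc k) , ⟪γAux⟫≤δAux (11 + k) k
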